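{- Let $\mathbb{B}=(p\multimap p)\multimap (p\multimap p)\otimes(p\multimap p)$, whose two $\beta\eta$-long normal forms are $$\mathtt{True''} = \lambda x.\,(\lambda z.z,\ \lambda y.\,x\,y),\qquad \mathtt{False''}=\lambda x.\,(\lambda y.\,x\,y,\ \lambda z.z).$$ Then there exist closed terms $\mathtt{not''}$, $\mathtt{and''}$ and $\mathtt{Copy''}$ of Linear Lambda Calculus (with $\multimap$ and $\otimes$, no weakening or contraction), such that each of the following applications is well-typed (after instantiating type variables) and $$\mathtt{not''}\,\mathtt{True''}=_{\beta\eta}\mathtt{False''},\qquad \mathtt{not''}\,\mathtt{False''}=_{\beta\eta}\mathtt{True''},$$ $$\mathtt{and''}\,\mathtt{True''}\,\mathtt{True''}=_{\beta\eta}\mathtt{True''},\quad \mathtt{and''}\,\mathtt{True''}\,\mathtt{False''}=_{\beta\eta}\mathtt{False''},\quad \mathtt{and''}\,\mathtt{False''}\,\mathtt{True''}=_{\beta\eta}\mathtt{False''},\quad \mathtt{and''}\,\mathtt{False''}\,\mathtt{False''}=_{\beta\eta}\mathtt{False''},$$ $$\mathtt{Copy''}\,\mathtt{True''}\Rightarrow^{*}(\mathtt{True''},\mathtt{True''}),\qquad \mathtt{Copy''}\,\mathtt{False''}\Rightarrow^{*}(\mathtt{False''},\mathtt{False''}).$$ Consequently all Boolean gates can be represented over $\mathbb{B}$ by linear terms.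
   Context: Linear Lambda Calculus here is the term calculus with types built from type variables $p$ (and other type variables), $\otimes$ and $\multimap$, with terms formed by variables, linear abstraction $\lambda x.t$, application $t\,s$, pairing $(s,t)$ and pair elimination $\mathtt{let\ (x,y)=s\ in\ t}$, where every bound variable is used exactly once and the free variables of the two components of an application or pair, and of $s$ and $t$ in a let, are disjoint. Reduction rules are $\beta$: $(\lambda x.t)s\Rightarrow t[s/x]$, $\otimes$-reduction: $\mathtt{let\ (x,y)=(u,v)\ in\ w}\Rightarrow w[u/x,v/y]$, and $\eta$: $t\Rightarrow \lambda x.\,t\,x$; $=_{\beta\eta}$ is the congruence generated by these, and $\Rightarrow^*$ denotes multi-step reduction. Typing is in the ML sense: a closed term has a principal polymorphic type whose type variables may be instantiated differently at different uses. -}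

module Defs where

open import Data.Nat using (ℕ; zero; suc; _+_; _≡ᵇ_)
open import Data.Bool using (if_then_else_)
open import Data.List using (List; []; _∷_)
open import Data.Product using (Σ; ∃; _×_; _,_)
open import Relation.Binary.PropositionalEquality using (_≡_)
open import Relation.Binary.Construct.Closure.ReflexiveTransitive using (Star)
open import Relation.Binary.Construct.Closure.Equivalence using (EqClosure)

infixr 7 _⊸_
infixr 8 _⊗_

data Ty : Set where
  tv  : ℕ → Ty
  _⊗_ : Ty → Ty → Ty
  _⊸_ : Ty → Ty → Ty

p : Ty
p = tv 0

𝔹 : Ty
𝔹 = (p ⊸ p) ⊸ ((p ⊸ p) ⊗ (p ⊸ p))

-- Raw terms (de Bruijn indices).
--   lam t      : λx.t, x is index 0 in t
--   letp s w   : let (x,y) = s in w,  y is index 0 and x is index 1 in w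

data Tm : Set where
  var  : ℕ → Tm
  lam  : Tm → Tm
  app  : Tm → Tm → Tm
  pair : Tm → Tm → Tm
  letp : Tm → Tm → Tm

ext : (ℕ → ℕ) → ℕ → ℕ
ext ρ zero    = zero
ext ρ (suc n) = suc (ρ n)

rename : (ℕ → ℕ) → Tm → Tm
rename ρ (var n)    = var (ρ n)
rename ρ (lam t)    = lam (rename (ext ρ) t)
rename ρ (app t s)  = app (rename ρ t) (rename ρ s)
rename ρ (pair t s) = pair (rename ρ t) (rename ρ s)
rename ρ (letp s w) = letp (rename ρ s) (rename (ext (ext ρ)) w)

exts : (ℕ → Tm) → ℕ → Tm
exts σ zero    = var zero
exts σ (suc n) = rename suc (σ n)

subst : (ℕ → Tm) → Tm → Tm
subst σ (var n)    = σ n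
subst σ (lam t)    = lam (subst (exts σ) t)
subst σ (app t s)  = app (subst σ t) (subst σ s)
subst σ (pair t s) = pair (subst σ t) (subst σ s)
subst σ (letp s w) = letp (subst σ s) (subst (exts (exts σ)) w)

σ₁ : Tm → ℕ → Tm
σ₁ s zero    = s
σ₁ s (suc n) = var n

_[_] : Tm → Tm → Tm
t [ s ] = subst (σ₁ s) t

σ₂ : Tm → Tm → ℕ → Tm
σ₂ u v zero          = v
σ₂ u v (suc zero)    = u
σ₂ u v (suc (suc n)) = var n

_[_∣_] : Tm → Tm → Tm → Tm
w [ u ∣ v ] = subst (σ₂ u v) w

occ : ℕ → Tm → ℕ
occ n (var m) = if n ≡ᵇ m then 1 else 0
occ n (lam t)    = occ (suc n) t
occ n (app t s)  = occ n t + occ n s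
occ n (pair t s) = occ n t + occ n s
occ n (letp s w) = occ n s + occ (suc (suc n)) w

data Linear : Tm → Set where
  var  : ∀ {n} → Linear (var n)
  lam  : ∀ {t} → Linear t → occ 0 t ≡ 1 → Linear (lam t)
  app  : ∀ {t s} → Linear t → Linear s → Linear (app t s)
  pair : ∀ {t s} → Linear t → Linear s → Linear (pair t s)
  letp : ∀ {s w} → Linear s → Linear w → occ 0 w ≡ 1 → occ 1 w ≡ 1
       → Linear (letp s w)

-- Typing (Curry style; type variables may be instantiated arbitrarily,
-- so a closed subterm can be used at any instance of its type).

Ctx : Set
Ctx = List Ty

data _∋_∶_ : Ctx → ℕ → Ty → Set where
  here  : ∀ {Γ A} → (A ∷ Γ) ∋ zero ∶ A
  there : ∀ {Γ A B n} → Γ ∋ n ∶ A → (B ∷ Γ) ∋ suc n ∶ A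

infix 4 _⊢_∶_
data _⊢_∶_ : Ctx → Tm → Ty → Set where
  var  : ∀ {Γ n A} → Γ ∋ n ∶ A → Γ ⊢ var n ∶ A
  lam  : ∀ {Γ t A B} → (A ∷ Γ) ⊢ t ∶ B → Γ ⊢ lam t ∶ A ⊸ B
  app  : ∀ {Γ t s A B} → Γ ⊢ t ∶ A ⊸ B → Γ ⊢ s ∶ A → Γ ⊢ app t s ∶ B
  pair : ∀ {Γ t s A B} → Γ ⊢ t ∶ A → Γ ⊢ s ∶ B → Γ ⊢ pair t s ∶ A ⊗ B
  letp : ∀ {Γ s w A B C} → Γ ⊢ s ∶ A ⊗ B → (B ∷ A ∷ Γ) ⊢ w ∶ C
       → Γ ⊢ letp s w ∶ C

WellTyped : Tm → Set
WellTyped t = ∃ λ A → [] ⊢ t ∶ A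

LinClosed : Tm → Set
LinClosed t = Linear t × WellTyped t

infix 4 _⇒_
data _⇒_ : Tm → Tm → Set where
  β     : ∀ {t s} → app (lam t) s ⇒ t [ s ]
  β⊗    : ∀ {u v w} → letp (pair u v) w ⇒ w [ u ∣ v ]
  η     : ∀ {t} → t ⇒ lam (app (rename suc t) (var 0))
  ξlam  : ∀ {t t'} → t ⇒ t' → lam t ⇒ lam t'
  ξappˡ : ∀ {t t' s} → t ⇒ t' → app t s ⇒ app t' s
  ξappʳ : ∀ {t s s'} → s ⇒ s' → app t s ⇒ app t s'
  ξpairˡ : ∀ {t t' s} → t ⇒ t' → pair t s ⇒ pair t' s
  ξpairʳ : ∀ {t s s'} → s ⇒ s' → pair t s ⇒ pair t s'
  ξletˡ : ∀ {s s' w} → s ⇒ s' → letp s w ⇒ letp s' w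
  ξletʳ : ∀ {s w w'} → w ⇒ w' → letp s w ⇒ letp s w'

infix 4 _⇒*_
_⇒*_ : Tm → Tm → Set
_⇒*_ = Star _⇒_

infix 4 _=βη_
_=βη_ : Tm → Tm → Set
_=βη_ = EqClosure _⇒_

-- True'' = λx.(λz.z, λy. x y)
True'' : Tm
True'' = lam (pair (lam (var 0)) (lam (app (var 1) (var 0))))

-- False'' = λx.(λy. x y, λz.z)
False'' : Tm
False'' = lam (pair (lam (app (var 1) (var 0))) (lam (var 0)))

module Submission where

-- A Boolean b : 𝔹 is a "switch": applied to x it returns the pair (id, x)
-- for True'' and (x, id) for False'' (x η-expanded).  Hence
--   * negation swaps the two components of  b x;
--   * conjunction runs  b x = (a₁, a₂), feeds a₂ to c giving (c₁, c₂) and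
--     returns (a₁ ∘ c₁, c₂);
--   * copying uses b at a larger carrier, P = 𝔹 ⊗ Bool (𝔹 ⊗ 𝔹) where
--     Bool C is 𝔹 with p replaced by C: b selects either
--     the identity or "negate both" to apply to the pairs (True'', False'')
--     and (False'', True''); one component of each result is the desired
--     copy, the other is a spare Boolean which is consumed linearly by
--     `discard` (apply it to id and compose the two identities it yields).

open import Defs
open import Data.Nat using (ℕ; zero; suc; _≟_)
open import Data.List using ([]; _∷_)
open import Data.Maybe using (Maybe; just; nothing; _<∣>_)
import Data.Maybe as Maybe
open import Data.Product using (Σ; ∃; _×_; _,_; proj₁; proj₂; map; map₂; uncurry)
open import Relation.Binary.PropositionalEquality using (_≡_; refl)
open import Relation.Nullary using (Dec; yes)
open import Relation.Nullary.Decidable using (map′; _×-dec_; from-yes)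
open import Relation.Binary.Construct.Closure.ReflexiveTransitive using (ε; _◅_)
import Relation.Binary.Construct.Closure.ReflexiveTransitive as Star
open import Relation.Binary.Construct.Closure.Symmetric using (fwd)

Bool : Ty → Ty
Bool C = (C ⊸ C) ⊸ ((C ⊸ C) ⊗ (C ⊸ C))

Renaming : Ctx → Ctx → (ℕ → ℕ) → Set
Renaming Γ Δ ρ = ∀ {n A} → Γ ∋ n ∶ A → Δ ∋ ρ n ∶ A

ext-renaming : ∀ {Γ Δ ρ B} → Renaming Γ Δ ρ → Renaming (B ∷ Γ) (B ∷ Δ) (ext ρ)
ext-renaming r here      = here
ext-renaming r (there x) = there (r x)

rename-⊢ : ∀ {Γ Δ ρ t A} → Renaming Γ Δ ρ → Γ ⊢ t ∶ A → Δ ⊢ rename ρ t ∶ A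
rename-⊢ r (var x)      = var (r x)
rename-⊢ r (lam ⊢t)     = lam (rename-⊢ (ext-renaming r) ⊢t)
rename-⊢ r (app ⊢t ⊢s)  = app (rename-⊢ r ⊢t) (rename-⊢ r ⊢s)
rename-⊢ r (pair ⊢t ⊢s) = pair (rename-⊢ r ⊢t) (rename-⊢ r ⊢s)
rename-⊢ r (letp ⊢s ⊢w) =
  letp (rename-⊢ r ⊢s) (rename-⊢ (ext-renaming (ext-renaming r)) ⊢w)

-- Linearity is decidable, so linearity of concrete terms is a computation.
linear? : (t : Tm) → Dec (Linear t)
linear? (var n)    = yes var
linear? (lam t)    = map′ (uncurry lam) (λ { (lam l o) → l , o })
                       (linear? t ×-dec (occ 0 t ≟ 1))
linear? (app t s)  = map′ (uncurry app) (λ { (app l k) → l , k })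
                       (linear? t ×-dec linear? s)
linear? (pair t s) = map′ (uncurry pair) (λ { (pair l k) → l , k })
                       (linear? t ×-dec linear? s)
linear? (letp s w) =
  map′ (λ (l , k , o₀ , o₁) → letp l k o₀ o₁)
       (λ { (letp l k o₀ o₁) → l , k , o₀ , o₁ })
       (linear? s ×-dec linear? w ×-dec (occ 0 w ≟ 1) ×-dec (occ 1 w ≟ 1))

under : ∀ {u t} (C : Tm → Tm) → (∀ {t'} → t ⇒ t' → u ⇒ C t')
      → Maybe (∃ (t ⇒_)) → Maybe (∃ (u ⇒_))
under C ξ = Maybe.map (map C ξ)

step : (t : Tm) → Maybe (∃ (t ⇒_))
step (app (lam t) s)     = just (_ , β)
step (letp (pair u v) w) = just (_ , β⊗)
step (var n)             = nothing
step (lam t)    = under lam ξlam (step t)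
step (app t s)  = under (λ t' → app t' s) ξappˡ (step t) <∣> under (app t) ξappʳ (step s)
step (pair t s) = under (λ t' → pair t' s) ξpairˡ (step t) <∣> under (pair t) ξpairʳ (step s)
step (letp s w) = under (λ s' → letp s' w) ξletˡ (step s) <∣> under (letp s) ξletʳ (step w)

normalise : ℕ → (t : Tm) → ∃ (t ⇒*_)
normalise zero    t = t , ε
normalise (suc n) t with step t
... | nothing      = t , ε
... | just (t' , r) = map₂ (r ◅_) (normalise n t')

reducesTo : ∀ n t u → proj₁ (normalise n t) ≡ u → t ⇒* u
reducesTo n t u refl = proj₂ (normalise n t)

⇒*⇒=βη : ∀ {t u} → t ⇒* u → t =βη u
⇒*⇒=βη = Star.map fwd

I : Tm
I = lam (var 0)

-- not'' = λb.λx. let (a, c) = b x in (c, a)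
NOT : Tm
NOT = lam (lam (letp (app (var 1) (var 0)) (pair (var 0) (var 1))))

-- and'' = λb.λc.λx. let (a₁, a₂) = b x in let (c₁, c₂) = c a₂ in (λz. a₁ (c₁ z), c₂)
AND : Tm
AND = lam (lam (lam (letp (app (var 2) (var 0))
        (letp (app (var 3) (var 0)) (pair (lam (app (var 4) (app (var 2) (var 0)))) (var 0))))))

-- negate both components:  λq. let (x, y) = q in (not'' x, not'' y)
NOT⊗NOT : Tm
NOT⊗NOT = lam (letp (var 0) (pair (app NOT (var 1)) (app NOT (var 0))))

-- discard b t = let (h, k) = b I in h (k t)  consumes the Boolean b, keeping t
discard : Tm → Tm → Tm
discard b t = letp (app b I) (app (var 1) (app (var 0) (rename (λ n → suc (suc n)) t)))

-- Copy'' = λb. let (f, g) = b NOT⊗NOT in let (u₁, u₂) = f (True'', False'') in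
--          let (v₁, v₂) = g (False'', True'') in discard u₂ (discard v₂ (u₁, v₁))
COPY : Tm
COPY = lam (letp (app (var 0) NOT⊗NOT)
         (letp (app (var 1) (pair True'' False''))
           (letp (app (var 2) (pair False'' True''))
             (discard (var 2) (discard (var 0) (pair (var 3) (var 1)))))))

⊢True : ∀ {Γ A B C} → Γ ⊢ True'' ∶ (A ⊸ B) ⊸ ((C ⊸ C) ⊗ (A ⊸ B))
⊢True = lam (pair (lam (var here)) (lam (app (var (there here)) (var here))))

⊢False : ∀ {Γ A B C} → Γ ⊢ False'' ∶ (A ⊸ B) ⊸ ((A ⊸ B) ⊗ (C ⊸ C))
⊢False = lam (pair (lam (app (var (there here)) (var here))) (lam (var here)))

⊢I : ∀ {Γ A} → Γ ⊢ I ∶ A ⊸ A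
⊢I = lam (var here)

⊢NOT : ∀ {Γ A B} → Γ ⊢ NOT ∶ (A ⊸ (B ⊗ B)) ⊸ (A ⊸ (B ⊗ B))
⊢NOT = lam (lam (letp (app (var (there here)) (var here)) (pair (var here) (var (there here)))))

⊢AND : ∀ {Γ C} → Γ ⊢ AND ∶ Bool C ⊸ Bool C ⊸ Bool C
⊢AND = lam (lam (lam (letp (app (var (there (there here))) (var here))
         (letp (app (var (there (there (there here)))) (var here))
           (pair (lam (app (var (there (there (there (there here)))))
                      (app (var (there (there here))) (var here)))) (var here))))))

⊢NOT⊗NOT : ∀ {Γ C D} → Γ ⊢ NOT⊗NOT ∶ (Bool C ⊗ Bool D) ⊸ (Bool C ⊗ Bool D)
⊢NOT⊗NOT = lam (letp (var here) (pair (app ⊢NOT (var (there here))) (app ⊢NOT (var here))))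

⊢discard : ∀ {Γ b t C} → Γ ⊢ b ∶ Bool C → Γ ⊢ t ∶ C → Γ ⊢ discard b t ∶ C
⊢discard ⊢b ⊢t = letp (app ⊢b ⊢I)
  (app (var (there here)) (app (var here) (rename-⊢ (λ x → there (there x)) ⊢t)))

-- Copy'' uses its argument at carrier P = 𝔹 ⊗ Bool (𝔹 ⊗ 𝔹): the spare
-- Booleans u₂, v₂ live in Bool (𝔹 ⊗ 𝔹) so they can be discarded at 𝔹 ⊗ 𝔹.
⊢COPY : ∀ {Γ} → Γ ⊢ COPY ∶ Bool (𝔹 ⊗ Bool (𝔹 ⊗ 𝔹)) ⊸ (𝔹 ⊗ 𝔹)
⊢COPY = lam (letp (app (var here) ⊢NOT⊗NOT)
          (letp (app (var (there here)) (pair ⊢True ⊢False))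
            (letp (app (var (there (there here))) (pair ⊢False ⊢True))
              (⊢discard (var (there (there here)))
                (⊢discard (var here)
                  (pair (var (there (there (there here)))) (var (there here))))))))

⊢True𝔹 : [] ⊢ True'' ∶ 𝔹
⊢True𝔹 = ⊢True

⊢False𝔹 : [] ⊢ False'' ∶ 𝔹
⊢False𝔹 = ⊢False

⊢NOT𝔹 : [] ⊢ NOT ∶ 𝔹 ⊸ 𝔹
⊢NOT𝔹 = ⊢NOT

⊢AND𝔹 : [] ⊢ AND ∶ 𝔹 ⊸ 𝔹 ⊸ 𝔹
⊢AND𝔹 = ⊢AND

not-True : app NOT True'' ⇒* False''
not-True = reducesTo 10 _ _ refl

not-False : app NOT False'' ⇒* True''
not-False = reducesTo 10 _ _ refl

and-TT : app (app AND True'') True'' ⇒* True''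
and-TT = reducesTo 20 _ _ refl

and-TF : app (app AND True'') False'' ⇒* False''
and-TF = reducesTo 20 _ _ refl

and-FT : app (app AND False'') True'' ⇒* False''
and-FT = reducesTo 20 _ _ refl

and-FF : app (app AND False'') False'' ⇒* False''
and-FF = reducesTo 20 _ _ refl

copy-True : app COPY True'' ⇒* pair True'' True''
copy-True = reducesTo 100 _ _ refl

copy-False : app COPY False'' ⇒* pair False'' False''
copy-False = reducesTo 100 _ _ refl

mainTheorem2 : Σ Tm λ not'' → Σ Tm λ and'' → Σ Tm λ Copy''
    → LinClosed not'' × LinClosed and'' × LinClosed Copy''
    × WellTyped (app not'' True'') × WellTyped (app not'' False'')
    × WellTyped (app (app and'' True'') True'') × WellTyped (app (app and'' True'') False'')
    × WellTyped (app (app and'' False'') True'') × WellTyped (app (app and'' False'') False'')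
    × WellTyped (app Copy'' True'') × WellTyped (app Copy'' False'')
    × (app not'' True'' =βη False'') × (app not'' False'' =βη True'')
    × (app (app and'' True'') True'' =βη True'') × (app (app and'' True'') False'' =βη False'')
    × (app (app and'' False'') True'' =βη False'') × (app (app and'' False'') False'' =βη False'')
    × (app Copy'' True'' ⇒* pair True'' True'') × (app Copy'' False'' ⇒* pair False'' False'')
mainTheorem2 = NOT , AND , COPY ,
  (from-yes (linear? NOT) , _ , ⊢NOT𝔹) ,
  (from-yes (linear? AND) , _ , ⊢AND𝔹) ,
  (from-yes (linear? COPY) , _ , ⊢COPY) ,
  (_ , app ⊢NOT𝔹 ⊢True𝔹) , (_ , app ⊢NOT𝔹 ⊢False𝔹) ,
  (_ , app (app ⊢AND𝔹 ⊢True𝔹) ⊢True𝔹) , (_ , app (app ⊢AND𝔹 ⊢True𝔹) ⊢False𝔹) ,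
  (_ , app (app ⊢AND𝔹 ⊢False𝔹) ⊢True𝔹) , (_ , app (app ⊢AND𝔹 ⊢False𝔹) ⊢False𝔹) ,
  (_ , app ⊢COPY ⊢True) , (_ , app ⊢COPY ⊢False) ,
  ⇒*⇒=βη not-True , ⇒*⇒=βη not-False ,
  ⇒*⇒=βη and-TT , ⇒*⇒=βη and-TF , ⇒*⇒=βη and-FT , ⇒*⇒=βη and-FF ,
  copy-True , copy-False
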